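{- Let $\Sigma=\{0,1\}$, $P=\{x\in\{0,1\}^{\omega^2}: \forall m\ \exists^{<\infty}n\ x(m,n)=1\}$, and let $h$ and $R_1$ be as in the context. Then for every $x\in\Sigma^{\omega^2}$: $h(x)\in R_1$ if and only if $x\in P$; that is, $P=h^{ -1}(R_1)$.
   Context: $\Sigma^{\omega^2}$ is the set of families $x=(x(m,n))_{m,n\ge1}$ of letters of $\Sigma$. $A$ is a letter not in $\Sigma$. For $p\ge2$ let $B_p(x)=x(p,1)x(p-1,2)\cdots x(1,p)$ and $B'_p(x)=x(1,p)x(2,p-1)\cdots x(p,1)$; $\sigma_1=x(1,1)\,A\,B_2(x)\,A\,B_4(x)\,A\cdots$ (even $p\ge2$, increasing, each block followed by $A$), $\sigma_2=A\,B'_3(x)\,A\,B'_5(x)\,A\cdots$ (odd $p\ge3$, increasing, each block followed by $A$), and $h(x)=(\sigma_1,\sigma_2)$. $R_1$ is the set of pairs $(y_1,y_2)$ of $\omega$-words over $\Sigma\cup\{A\}$ for which there exist an integer $k\ge1$, words $U_k,V_k\in(\Sigma^\star A)^k$, a word $u\in\Sigma^\star$, and for all $i\ge1$ letters $t(i)\in\Sigma$, words $u_i,v_i\in0^\star$ and $g_i,z_i\in\Sigma^\star$ with $|v_i|=|u_i|$ and ($|g_i|=|z_i|+1$ or $|g_i|=|z_i|$), with $|g_i|=|z_i|$ for infinitely many $i$, such that $y_1=U_k\,u\,t(1)\,v_1\,A\,g_1\,t(3)\,v_2\,A\,g_2\,t(5)\,v_3\,A\cdots g_n\,t(2n+1)\,v_{n+1}\,A\cdots$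 and $y_2=V_k\,u_1\,t(2)\,z_1\,A\,u_2\,t(4)\,z_2\,A\cdots u_n\,t(2n)\,z_n\,A\cdots$. -}

module Defs where

open import Data.Nat using (ℕ; zero; suc; _≤_; _∸_; _+_; _*_)
open import Data.List using (List; []; _∷_; _++_; map; upTo; length)
open import Data.List.NonEmpty using (List⁺; _∷_; _∷ʳ_) renaming (head to head⁺; tail to tail⁺)
open import Data.List.Relation.Unary.All using (All)
open import Data.Vec using (Vec; []; _∷_)
open import Data.Product using (Σ; ∃; _×_; _,_)
open import Data.Sum using (_⊎_)
open import Relation.Binary.PropositionalEquality using (_≡_)
open import Relation.Nullary using (¬_)

data Bit : Set where
  b0 b1 : Bit

data Letter : Set where
  bit : Bit → Letter
  A   : Letter

⌜_⌝ : List Bit → List Letter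
⌜ w ⌝ = map bit w

-- ω-words over an alphabet L: functions ℕ → L (position 0 is the first letter).
-- Elements of Σ^{ω²}: x : ℕ → ℕ → Bit, where x m n stands for x(m,n);
-- only the values with m,n ≥ 1 are ever used.

private
  go : ∀ {L : Set} → L → List L → (ℕ → List⁺ L) → ℕ → L
  go a as       ws zero    = a
  go a (b ∷ bs) ws (suc i) = go b bs ws i
  go a []       ws (suc i) = go (head⁺ (ws 0)) (tail⁺ (ws 0)) (λ j → ws (suc j)) i

concatω : ∀ {L : Set} → (ℕ → List⁺ L) → ℕ → L
concatω ws = go (head⁺ (ws 0)) (tail⁺ (ws 0)) (λ j → ws (suc j))

sepω : (ℕ → List Letter) → ℕ → Letter
sepω ws = concatω (λ j → ws j ∷ʳ A)

_≈ω_ : ∀ {L : Set} → (ℕ → L) → (ℕ → L) → Set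
y ≈ω z = ∀ i → y i ≡ z i

-- B_p(x) = x(p,1) x(p-1,2) ⋯ x(1,p)
B : (ℕ → ℕ → Bit) → ℕ → List Bit
B x p = map (λ i → x (p ∸ i) (suc i)) (upTo p)

-- B'_p(x) = x(1,p) x(2,p-1) ⋯ x(p,1)
B' : (ℕ → ℕ → Bit) → ℕ → List Bit
B' x p = map (λ i → x (suc i) (p ∸ i)) (upTo p)

-- σ₁ = x(1,1) A B₂ A B₄ A ⋯
σ₁ : (ℕ → ℕ → Bit) → ℕ → Letter
σ₁ x = sepω blk
  where
  blk : ℕ → List Letter
  blk zero    = ⌜ x 1 1 ∷ [] ⌝
  blk (suc j) = ⌜ B x (2 * suc j) ⌝

-- σ₂ = A B'₃ A B'₅ A ⋯
σ₂ : (ℕ → ℕ → Bit) → ℕ → Letter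
σ₂ x = sepω blk
  where
  blk : ℕ → List Letter
  blk zero    = []
  blk (suc j) = ⌜ B' x (2 * suc j + 1) ⌝

P : (ℕ → ℕ → Bit) → Set
P x = ∀ m → 1 ≤ m → ∃ λ N → ∀ n → N ≤ n → ¬ (x m n ≡ b1)

-- Words in (Σ* A)^k, given by their decomposition into k pieces.
flat : ∀ {k} → Vec (List Bit) k → List Letter
flat []       = []
flat (w ∷ ws) = ⌜ w ⌝ ++ (A ∷ flat ws)

Zeros : List Bit → Set
Zeros w = All (_≡ b0) w

-- The relation R₁ (sequences t, u_i, v_i, g_i, z_i are indexed from 1;
-- their value at index 0 is irrelevant).
record R₁ (y₁ y₂ : ℕ → Letter) : Set where
  field
    k    : ℕ
    1≤k  : 1 ≤ k
    U V  : Vec (List Bit) k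
    u    : List Bit
    t    : ℕ → Bit
    us vs gs zs : ℕ → List Bit
    us0  : ∀ i → 1 ≤ i → Zeros (us i)
    vs0  : ∀ i → 1 ≤ i → Zeros (vs i)
    |v|≡|u| : ∀ i → 1 ≤ i → length (vs i) ≡ length (us i)
    |g|~|z| : ∀ i → 1 ≤ i →
              (length (gs i) ≡ suc (length (zs i))) ⊎ (length (gs i) ≡ length (zs i))
    inf  : ∀ N → ∃ λ i → N ≤ i × 1 ≤ i × length (gs i) ≡ length (zs i)
    -- y₁ = U_k u t(1) v₁ A g₁ t(3) v₂ A ⋯ g_n t(2n+1) v_{n+1} A ⋯
    eq₁  : y₁ ≈ω sepω (λ { zero    → flat U ++ ⌜ u ++ (t 1 ∷ vs 1) ⌝
                         ; (suc n) → ⌜ gs (suc n) ++ (t (2 * suc n + 1) ∷ vs (suc (suc n))) ⌝ })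
    -- y₂ = V_k u₁ t(2) z₁ A u₂ t(4) z₂ A ⋯ u_n t(2n) z_n A ⋯
    eq₂  : y₂ ≈ω sepω (λ { zero    → flat V ++ ⌜ us 1 ++ (t 2 ∷ zs 1) ⌝
                         ; (suc n) → ⌜ us (suc (suc n)) ++ (t (2 * suc (suc n)) ∷ zs (suc (suc n))) ⌝ })

-- Idea.  σ₁ and σ₂ list the antidiagonals of x: the p-th antidiagonal {(m,n) : m + n = p + 1} is
-- read by B_p towards row 1 and by B'_p away from row 1 (even p in σ₁, odd p in σ₂).  A pair in R₁
-- cuts B_{2q} as g t v and B'_{2q+1} as u t z with v, u ∈ 0* of one length r_q, i.e. the first r_q
-- rows of both antidiagonals vanish; the length constraints make r grow by 0 or 1 per step, and by
-- 1 whenever |g| = |z|, which happens infinitely often.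
--   R₁ ⇒ P: r is unbounded, so every row eventually lies in the vanishing region (P-from-diagonals).
--   P ⇒ R₁: row i+1 vanishes from antidiagonal Th i on; admitting rows one at a time once their
--   threshold is reached (module Admission) yields such a counter r, and cutting each antidiagonal
--   at row r_q + 1 yields the words required by R₁.

module Submission where

open import Defs
open import Data.Nat using (ℕ; zero; suc; _≤_; _<_; _∸_; _+_; _*_; z≤n; s≤s; _≤?_)
open import Data.Nat.Properties
open import Data.Nat.Tactic.RingSolver using (solve-∀)
open import Data.List using (List; []; _∷_; _++_; [_]; length; applyUpTo; applyDownFrom)
open import Data.List.Properties
  using (++-assoc; length-++; map-upTo; length-applyUpTo; length-applyDownFrom; ∷-injectiveˡ; ∷-injectiveʳ)
open import Data.List.NonEmpty using (List⁺; _∷_; _∷ʳ_; toList) renaming (head to head⁺; tail to tail⁺)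
open import Data.List.Relation.Unary.All using (All; []; _∷_)
open import Data.List.Relation.Unary.All.Properties using (applyUpTo⁺₁; applyUpTo⁻; applyDownFrom⁺₁)
open import Data.Vec using (Vec; []; _∷_)
open import Data.Product using (∃; _×_; _,_; proj₁; proj₂)
open import Data.Sum using (_⊎_; inj₁; inj₂)
open import Data.Empty using (⊥-elim)
open import Function using (_∘_)
open import Relation.Nullary using (¬_; yes; no)
open import Relation.Binary.Bundles using (Setoid)
open import Relation.Binary.PropositionalEquality
  using (_≡_; refl; sym; trans; cong; cong₂; subst; _→-setoid_)

infixr 5 _++ω_
_++ω_ : ∀ {L : Set} → List L → (ℕ → L) → ℕ → L
([] ++ω y) i = y i
((a ∷ u) ++ω y) zero = a
((a ∷ u) ++ω y) (suc i) = (u ++ω y) i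

++ω-cong : ∀ {L : Set} (u : List L) {y z : ℕ → L} → y ≈ω z → (u ++ω y) ≈ω (u ++ω z)
++ω-cong [] y≈z i = y≈z i
++ω-cong (a ∷ u) y≈z zero = refl
++ω-cong (a ∷ u) y≈z (suc i) = ++ω-cong u y≈z i

++ω-assoc : ∀ {L : Set} (u v : List L) (y : ℕ → L) → ((u ++ v) ++ω y) ≈ω (u ++ω (v ++ω y))
++ω-assoc [] v y i = refl
++ω-assoc (a ∷ u) v y zero = refl
++ω-assoc (a ∷ u) v y (suc i) = ++ω-assoc u v y i

ωSetoid : Setoid _ _
ωSetoid = ℕ →-setoid Letter

open Setoid ωSetoid using () renaming (sym to ≈ω-sym)
open import Relation.Binary.Reasoning.Setoid ωSetoid

_◂_ : ∀ {L : Set} → List⁺ L → (ℕ → List⁺ L) → ℕ → List⁺ L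
(w ◂ ws) zero = w
(w ◂ ws) (suc j) = ws j

concatω-◂ : ∀ {L : Set} (a : L) as (ws : ℕ → List⁺ L) →
  concatω ((a ∷ as) ◂ ws) ≈ω ((a ∷ as) ++ω concatω ws)
concatω-◂ a [] ws zero = refl
concatω-◂ a [] ws (suc i) = refl
concatω-◂ a (b ∷ bs) ws zero = refl
concatω-◂ a (b ∷ bs) ws (suc i) = concatω-◂ b bs ws i

concatω-unfold : ∀ {L : Set} (ws : ℕ → List⁺ L) → concatω ws ≈ω (toList (ws 0) ++ω concatω (ws ∘ suc))
concatω-unfold ws = concatω-◂ (head⁺ (ws 0)) (tail⁺ (ws 0)) (ws ∘ suc)

concatω-◂-cong : ∀ {L : Set} (a : L) as (ws ws′ : ℕ → List⁺ L) → (∀ j → ws j ≡ ws′ j) →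
  concatω ((a ∷ as) ◂ ws) ≈ω concatω ((a ∷ as) ◂ ws′)
concatω-◂-cong a as ws ws′ eq zero = refl
concatω-◂-cong a (b ∷ bs) ws ws′ eq (suc i) = concatω-◂-cong b bs ws ws′ eq i
concatω-◂-cong a [] ws ws′ eq (suc i) with ws 0 | ws′ 0 | eq 0
... | w | .w | refl = concatω-◂-cong (head⁺ w) (tail⁺ w) (ws ∘ suc) (ws′ ∘ suc) (eq ∘ suc) i

concatω-cong : ∀ {L : Set} (ws ws′ : ℕ → List⁺ L) → (∀ j → ws j ≡ ws′ j) → concatω ws ≈ω concatω ws′
concatω-cong ws ws′ eq i =
  trans (concatω-◂-cong (head⁺ (ws 0)) (tail⁺ (ws 0)) (ws ∘ suc) (ws′ ∘ suc) (eq ∘ suc) i)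
        (cong (λ w → concatω (w ◂ (ws′ ∘ suc)) i) (eq 0))

toList-∷ʳ : ∀ {L : Set} (u : List L) (a : L) → toList (u ∷ʳ a) ≡ u ++ [ a ]
toList-∷ʳ [] a = refl
toList-∷ʳ (b ∷ u) a = refl

sepω-unfold : (ws : ℕ → List Letter) → sepω ws ≈ω (ws 0 ++ω [ A ] ++ω sepω (ws ∘ suc))
sepω-unfold ws = begin
  sepω ws                                  ≈⟨ concatω-unfold (λ j → ws j ∷ʳ A) ⟩
  toList (ws 0 ∷ʳ A) ++ω sepω (ws ∘ suc)   ≡⟨ cong (_++ω sepω (ws ∘ suc)) (toList-∷ʳ (ws 0) A) ⟩
  (ws 0 ++ [ A ]) ++ω sepω (ws ∘ suc)      ≈⟨ ++ω-assoc (ws 0) [ A ] _ ⟩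
  ws 0 ++ω [ A ] ++ω sepω (ws ∘ suc)       ∎

sepω-cong : (ws ws′ : ℕ → List Letter) → (∀ j → ws j ≡ ws′ j) → sepω ws ≈ω sepω ws′
sepω-cong ws ws′ eq = concatω-cong _ _ (λ j → cong (_∷ʳ A) (eq j))

-- Reading an ω-word: a block over Σ ends exactly at the first A, so ⌜a⌝ A y determines a and y.
separator-cancel : (a b : List Bit) {y z : ℕ → Letter} →
  (⌜ a ⌝ ++ω [ A ] ++ω y) ≈ω (⌜ b ⌝ ++ω [ A ] ++ω z) → a ≡ b × y ≈ω z
separator-cancel [] [] eq = refl , eq ∘ suc
separator-cancel [] (b ∷ bs) eq with eq 0
... | ()
separator-cancel (a ∷ as) [] eq with eq 0
... | ()
separator-cancel (a ∷ as) (b ∷ bs) eq with eq 0 | separator-cancel as bs (eq ∘ suc)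
... | refl | refl , y≈z = refl , y≈z

sepω-injective : (c d : ℕ → List Bit) →
  sepω (λ j → ⌜ c j ⌝) ≈ω sepω (λ j → ⌜ d j ⌝) → ∀ j → c j ≡ d j
sepω-injective c d eq j with separator-cancel (c 0) (d 0) (begin
    ⌜ c 0 ⌝ ++ω [ A ] ++ω sepω (λ j → ⌜ c (suc j) ⌝) ≈⟨ ≈ω-sym (sepω-unfold (λ j → ⌜ c j ⌝)) ⟩
    sepω (λ j → ⌜ c j ⌝)                            ≈⟨ eq ⟩
    sepω (λ j → ⌜ d j ⌝)                            ≈⟨ sepω-unfold (λ j → ⌜ d j ⌝) ⟩
    ⌜ d 0 ⌝ ++ω [ A ] ++ω sepω (λ j → ⌜ d (suc j) ⌝) ∎)
... | c₀≡d₀ , rest with j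
...   | zero = c₀≡d₀
...   | suc j′ = sepω-injective (c ∘ suc) (d ∘ suc) rest j′

sepω-drop-flat : ∀ {k} (U : Vec (List Bit) k) (c : ℕ → List Bit) (y : ℕ → Letter) →
  sepω (λ j → ⌜ c j ⌝) ≈ω (flat U ++ω y) → sepω (λ j → ⌜ c (k + j) ⌝) ≈ω y
sepω-drop-flat [] c y eq = eq
sepω-drop-flat (w ∷ U) c y eq =
  sepω-drop-flat U (c ∘ suc) y (proj₂ (separator-cancel (c 0) w (begin
    ⌜ c 0 ⌝ ++ω [ A ] ++ω sepω (λ j → ⌜ c (suc j) ⌝) ≈⟨ ≈ω-sym (sepω-unfold (λ j → ⌜ c j ⌝)) ⟩
    sepω (λ j → ⌜ c j ⌝)                            ≈⟨ eq ⟩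
    (⌜ w ⌝ ++ A ∷ flat U) ++ω y                     ≈⟨ ++ω-assoc ⌜ w ⌝ (A ∷ flat U) y ⟩
    ⌜ w ⌝ ++ω (A ∷ flat U) ++ω y                    ≈⟨ ++ω-cong ⌜ w ⌝ (++ω-assoc [ A ] (flat U) y) ⟩
    ⌜ w ⌝ ++ω [ A ] ++ω flat U ++ω y                ∎)))

sepω-parse : ∀ {k} (U : Vec (List Bit) k) (c w : ℕ → List Bit) (R : ℕ → List Letter) →
  sepω (λ j → ⌜ c j ⌝) ≈ω sepω R → R 0 ≡ flat U ++ ⌜ w 0 ⌝ → (∀ n → R (suc n) ≡ ⌜ w (suc n) ⌝) →
  ∀ j → c (k + j) ≡ w j
sepω-parse {k} U c w R eq R₀ Rₛ = sepω-injective (λ j → c (k + j)) w (sepω-drop-flat U c _ (begin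
  sepω (λ j → ⌜ c j ⌝)                                     ≈⟨ eq ⟩
  sepω R                                                   ≈⟨ sepω-unfold R ⟩
  R 0 ++ω [ A ] ++ω sepω (R ∘ suc)                          ≡⟨ cong (_++ω [ A ] ++ω sepω (R ∘ suc)) R₀ ⟩
  (flat U ++ ⌜ w 0 ⌝) ++ω [ A ] ++ω sepω (R ∘ suc)          ≈⟨ ++ω-assoc (flat U) ⌜ w 0 ⌝ _ ⟩
  flat U ++ω ⌜ w 0 ⌝ ++ω [ A ] ++ω sepω (R ∘ suc)           ≈⟨ ++ω-cong (flat U) (++ω-cong ⌜ w 0 ⌝
                                                                 (++ω-cong [ A ] (sepω-cong _ _ Rₛ))) ⟩
  flat U ++ω ⌜ w 0 ⌝ ++ω [ A ] ++ω sepω (λ j → ⌜ w (suc j) ⌝) ≈⟨ ++ω-cong (flat U) (≈ω-sym (sepω-unfold (λ j → ⌜ w j ⌝))) ⟩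
  flat U ++ω sepω (λ j → ⌜ w j ⌝)                          ∎))

sepω-merge : (ws R : ℕ → List Letter) → R 0 ≡ ws 0 ++ A ∷ ws 1 → (∀ n → R (suc n) ≡ ws (suc (suc n))) →
  sepω ws ≈ω sepω R
sepω-merge ws R R₀ Rₛ = begin
  sepω ws                                                   ≈⟨ sepω-unfold ws ⟩
  ws 0 ++ω [ A ] ++ω sepω (ws ∘ suc)                         ≈⟨ ++ω-cong (ws 0) (++ω-cong [ A ] (sepω-unfold (ws ∘ suc))) ⟩
  ws 0 ++ω [ A ] ++ω ws 1 ++ω [ A ] ++ω sepω (ws ∘ suc ∘ suc) ≈⟨ ++ω-cong (ws 0) (≈ω-sym (++ω-assoc [ A ] (ws 1) _)) ⟩
  ws 0 ++ω (A ∷ ws 1) ++ω [ A ] ++ω sepω (ws ∘ suc ∘ suc)     ≈⟨ ≈ω-sym (++ω-assoc (ws 0) (A ∷ ws 1) _) ⟩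
  (ws 0 ++ A ∷ ws 1) ++ω [ A ] ++ω sepω (ws ∘ suc ∘ suc)      ≡⟨ cong (_++ω [ A ] ++ω sepω (ws ∘ suc ∘ suc)) (sym R₀) ⟩
  R 0 ++ω [ A ] ++ω sepω (ws ∘ suc ∘ suc)                    ≈⟨ ++ω-cong (R 0) (++ω-cong [ A ] (sepω-cong _ _ (sym ∘ Rₛ))) ⟩
  R 0 ++ω [ A ] ++ω sepω (R ∘ suc)                           ≈⟨ ≈ω-sym (sepω-unfold R) ⟩
  sepω R                                                    ∎

-- Elimination of All for applyDownFrom (the library provides only the introduction rule).
applyDownFrom⁻ : ∀ {L : Set} {Q : L → Set} (f : ℕ → L) n → All Q (applyDownFrom f n) → ∀ {i} → i < n → Q (f i)
applyDownFrom⁻ f (suc n) (qₙ ∷ qs) i<1+n with m<1+n⇒m<n∨m≡n i<1+n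
... | inj₁ i<n = applyDownFrom⁻ f n qs i<n
... | inj₂ refl = qₙ

applyUpTo-prefix : ∀ {L : Set} (f : ℕ → L) n (u w : List L) →
  applyUpTo f n ≡ u ++ w → u ≡ applyUpTo f (length u)
applyUpTo-prefix f n [] w eq = refl
applyUpTo-prefix f (suc n) (a ∷ u) w eq =
  cong₂ _∷_ (sym (∷-injectiveˡ eq)) (applyUpTo-prefix (f ∘ suc) n u w (∷-injectiveʳ eq))

applyDownFrom-suffix : ∀ {L : Set} (f : ℕ → L) n (g v : List L) →
  applyDownFrom f n ≡ g ++ v → v ≡ applyDownFrom f (length v)
applyDownFrom-suffix f n [] v eq =
  subst (λ m → v ≡ applyDownFrom f m) (trans (sym (length-applyDownFrom f n)) (cong length eq)) (sym eq)
applyDownFrom-suffix f (suc n) (a ∷ g) v eq = applyDownFrom-suffix f n g v (∷-injectiveʳ eq)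

applyUpTo-split : ∀ {L : Set} (f : ℕ → L) r a →
  applyUpTo f (r + suc a) ≡ applyUpTo f r ++ f r ∷ applyUpTo (λ i → f (r + suc i)) a
applyUpTo-split f zero a = refl
applyUpTo-split f (suc r) a = cong (f 0 ∷_) (applyUpTo-split (f ∘ suc) r a)

applyDownFrom-split : ∀ {L : Set} (f : ℕ → L) a r →
  applyDownFrom f (a + suc r) ≡ applyDownFrom (λ i → f (i + suc r)) a ++ f r ∷ applyDownFrom f r
applyDownFrom-split f zero r = refl
applyDownFrom-split f (suc a) r = cong (f (a + suc r) ∷_) (applyDownFrom-split f a r)

applyUpTo-reverse : ∀ {L : Set} (f g : ℕ → L) n → (∀ i → i < n → g i ≡ f (n ∸ suc i)) →
  applyUpTo g n ≡ applyDownFrom f n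
applyUpTo-reverse f g zero eq = refl
applyUpTo-reverse f g (suc n) eq =
  cong₂ _∷_ (eq 0 (s≤s z≤n)) (applyUpTo-reverse f (g ∘ suc) n (λ i i<n → eq (suc i) (s≤s i<n)))

-- diag x p i = x(i+1, p-i): the entry in row i+1 of the p-th antidiagonal {(m,n) : m + n = p + 1}.
diag : (ℕ → ℕ → Bit) → ℕ → ℕ → Bit
diag x p i = x (suc i) (p ∸ i)

B'-diag : ∀ x p → B' x p ≡ applyUpTo (diag x p) p
B'-diag x p = map-upTo (diag x p) p

B-diag : ∀ x p → B x p ≡ applyDownFrom (diag x p) p
B-diag x p = trans (map-upTo _ p) (applyUpTo-reverse (diag x p) _ p reindex)
  where
  reindex : ∀ i → i < p → x (p ∸ i) (suc i) ≡ diag x p (p ∸ suc i)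
  reindex i i<p = cong₂ x (+-∸-assoc 1 i<p) (sym (m∸[m∸n]≡n i<p))

DiagZero : (ℕ → ℕ → Bit) → ℕ → ℕ → Set
DiagZero x p r = ∀ i → i < r → diag x p i ≡ b0

B-suffix-zero : ∀ x p (g v : List Bit) → B x p ≡ g ++ v → Zeros v → DiagZero x p (length v)
B-suffix-zero x p g v eq zeros i =
  applyDownFrom⁻ (diag x p) (length v)
    (subst Zeros (applyDownFrom-suffix (diag x p) p g v (trans (sym (B-diag x p)) eq)) zeros)

B'-prefix-zero : ∀ x p (u w : List Bit) → B' x p ≡ u ++ w → Zeros u → DiagZero x p (length u)
B'-prefix-zero x p u w eq zeros i =
  applyUpTo⁻ (diag x p) (length u)
    (subst Zeros (applyUpTo-prefix (diag x p) p u w (trans (sym (B'-diag x p)) eq)) zeros)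

B-split : ∀ x p a r → p ≡ a + suc r →
  B x p ≡ applyDownFrom (λ i → diag x p (i + suc r)) a ++ diag x p r ∷ applyDownFrom (diag x p) r
B-split x p a r p≡ =
  trans (B-diag x p) (trans (cong (applyDownFrom (diag x p)) p≡) (applyDownFrom-split (diag x p) a r))

B'-split : ∀ x p r a → p ≡ r + suc a →
  B' x p ≡ applyUpTo (diag x p) r ++ diag x p r ∷ applyUpTo (λ i → diag x p (r + suc i)) a
B'-split x p r a p≡ =
  trans (B'-diag x p) (trans (cong (applyUpTo (diag x p)) p≡) (applyUpTo-split (diag x p) r a))

length-B : ∀ x p → length (B x p) ≡ p
length-B x p = trans (cong length (B-diag x p)) (length-applyDownFrom (diag x p) p)

length-B' : ∀ x p → length (B' x p) ≡ p
length-B' x p = trans (cong length (B'-diag x p)) (length-applyUpTo (diag x p) p)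

mono-≤ : (f : ℕ → ℕ) → (∀ j → f j ≤ f (suc j)) → ∀ {i j} → i ≤ j → f i ≤ f j
mono-≤ f step {j = zero} z≤n = ≤-refl
mono-≤ f step {j = suc j} i≤1+j with m≤n⇒m<n∨m≡n i≤1+j
... | inj₁ (s≤s i≤j) = ≤-trans (mono-≤ f step i≤j) (step j)
... | inj₂ refl = ≤-refl

eventually-above : (f : ℕ → ℕ) → (∀ j → f j ≤ f (suc j)) → (∀ N → ∃ λ j → N ≤ j × f j < f (suc j)) →
  ∀ m → ∃ λ j₀ → ∀ j → j₀ ≤ j → m ≤ f j
eventually-above f step grows zero = 0 , λ _ _ → z≤n
eventually-above f step grows (suc m) with eventually-above f step grows m
... | j₀ , above with grows j₀
...   | j , j₀≤j , increase =
  suc j , λ j′ 1+j≤j′ → ≤-trans (≤-trans (s≤s (above j j₀≤j)) increase) (mono-≤ f step 1+j≤j′)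

even-or-odd : ∀ n → ∃ λ q → n ≡ 2 * q ⊎ n ≡ 2 * q + 1
even-or-odd zero = 0 , inj₁ refl
even-or-odd (suc n) with even-or-odd n
... | q , inj₁ n≡2q = q , inj₂ (trans (cong suc n≡2q) (+-comm 1 (2 * q)))
... | q , inj₂ n≡2q+1 = suc q , inj₁ (trans (cong suc n≡2q+1) (next-even q))
  where
  next-even : ∀ q → suc (2 * q + 1) ≡ 2 * suc q
  next-even = solve-∀

parity-above : ∀ K p → 2 * K ≤ p → ∃ λ q → p ≡ 2 * (K + q) ⊎ p ≡ 2 * (K + q) + 1
parity-above K p 2K≤p with m≤n⇒∃[o]m+o≡n 2K≤p
... | o , 2K+o≡p with even-or-odd o
...   | q , inj₁ o≡2q = q , inj₁ (trans (sym 2K+o≡p) (trans (cong (2 * K +_) o≡2q) (sym (*-distribˡ-+ 2 K q))))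
...   | q , inj₂ o≡2q+1 = q , inj₂ (trans (sym 2K+o≡p) (trans (cong (2 * K +_) o≡2q+1) (distrib-+1 K q)))
  where
  distrib-+1 : ∀ K q → 2 * K + (2 * q + 1) ≡ 2 * (K + q) + 1
  distrib-+1 = solve-∀

b0≢b1 : ¬ b0 ≡ b1
b0≢b1 ()

P-from-diagonals : ∀ x K (ρ : ℕ → ℕ) →
  (∀ q → DiagZero x (2 * (K + q)) (ρ q) × DiagZero x (2 * (K + q) + 1) (ρ q)) →
  (∀ m → ∃ λ q₀ → ∀ q → q₀ ≤ q → m ≤ ρ q) → P x
P-from-diagonals x K ρ zeros unbounded (suc i) _ with unbounded (suc i)
... | q₀ , above = 2 * (K + q₀) , λ n N≤n x≡b1 → b0≢b1 (trans (sym (entry-zero n N≤n)) x≡b1)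
  where
  -- x(i+1, n) lies on the antidiagonal i + n, which is 2(K+q₀+q) or 2(K+q₀+q)+1 for some q.
  entry-zero : ∀ n → 2 * (K + q₀) ≤ n → x (suc i) n ≡ b0
  entry-zero n N≤n with parity-above (K + q₀) (i + n) (≤-trans N≤n (m≤n+m n i))
  ... | q , i+n≡ = trans (cong (x (suc i)) (sym (m+n∸m≡n i n))) (on-diag i+n≡)
    where
    row-in-range : i < ρ (q₀ + q)
    row-in-range = above (q₀ + q) (m≤m+n q₀ q)
    reassoc : K + q₀ + q ≡ K + (q₀ + q)
    reassoc = +-assoc K q₀ q
    on-diag : i + n ≡ 2 * (K + q₀ + q) ⊎ i + n ≡ 2 * (K + q₀ + q) + 1 → diag x (i + n) i ≡ b0
    on-diag (inj₁ even) = subst (λ p → diag x p i ≡ b0) (sym (trans even (cong (2 *_) reassoc)))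
                            (proj₁ (zeros (q₀ + q)) i row-in-range)
    on-diag (inj₂ odd) = subst (λ p → diag x p i ≡ b0) (sym (trans odd (cong (λ s → 2 * s + 1) reassoc)))
                           (proj₂ (zeros (q₀ + q)) i row-in-range)

blocks₁ : (ℕ → ℕ → Bit) → ℕ → List Bit
blocks₁ x zero = x 1 1 ∷ []
blocks₁ x (suc j) = B x (2 * suc j)

blocks₂ : (ℕ → ℕ → Bit) → ℕ → List Bit
blocks₂ x zero = []
blocks₂ x (suc j) = B' x (2 * suc j + 1)

blocks₁-pos : ∀ x m → 1 ≤ m → blocks₁ x m ≡ B x (2 * m)
blocks₁-pos x (suc m) _ = refl

blocks₂-pos : ∀ x m → 1 ≤ m → blocks₂ x m ≡ B' x (2 * m + 1)
blocks₂-pos x (suc m) _ = refl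

-- Comparing the lengths of consecutive blocks of y₁ and y₂ in R₁: if |g| + 1 + r′ = r + 1 + |z| + 1,
-- then r′ = r when |g| = |z| + 1, and r′ = r + 1 when |g| = |z|.
length-step : ∀ g z r r′ → g + suc r′ ≡ suc (r + suc z) → (g ≡ suc z → r′ ≡ r) × (g ≡ z → r′ ≡ suc r)
length-step g z r r′ eq = stays , grows
  where
  rearrange₁ : ∀ r z → suc (r + suc z) ≡ suc z + suc r
  rearrange₁ = solve-∀
  rearrange₂ : ∀ r z → suc (r + suc z) ≡ z + suc (suc r)
  rearrange₂ = solve-∀
  stays : g ≡ suc z → r′ ≡ r
  stays g≡ = suc-injective (+-cancelˡ-≡ (suc z) _ _
    (trans (cong (_+ suc r′) (sym g≡)) (trans eq (rearrange₁ r z))))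
  grows : g ≡ z → r′ ≡ suc r
  grows g≡ = suc-injective (+-cancelˡ-≡ z _ _
    (trans (cong (_+ suc r′) (sym g≡)) (trans eq (rearrange₂ r z))))

module FromR₁ (x : ℕ → ℕ → Bit) (hx : R₁ (σ₁ x) (σ₂ x)) where
  open R₁ hx

  -- In y₁ the j-th block after U_k is g_j t(2j+1) v_{j+1} (with g₀ = u);
  -- in y₂ the j-th block after V_k is u_{j+1} t(2j+2) z_{j+1}.
  g : ℕ → List Bit
  g zero = u
  g (suc j) = gs (suc j)

  t-odd t-even : ℕ → Bit
  t-odd zero = t 1
  t-odd (suc j) = t (2 * suc j + 1)
  t-even zero = t 2
  t-even (suc j) = t (2 * suc (suc j))

  layout₁ layout₂ : ℕ → List Letter
  layout₁ zero = flat U ++ ⌜ u ++ t 1 ∷ vs 1 ⌝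
  layout₁ (suc n) = ⌜ gs (suc n) ++ t (2 * suc n + 1) ∷ vs (suc (suc n)) ⌝
  layout₂ zero = flat V ++ ⌜ us 1 ++ t 2 ∷ zs 1 ⌝
  layout₂ (suc n) = ⌜ us (suc (suc n)) ++ t (2 * suc (suc n)) ∷ zs (suc (suc n)) ⌝

  1≤k+ : ∀ j → 1 ≤ k + j
  1≤k+ j = ≤-trans 1≤k (m≤m+n k j)

  block₁ : ∀ j → B x (2 * (k + j)) ≡ g j ++ t-odd j ∷ vs (suc j)
  block₁ j = trans (sym (blocks₁-pos x (k + j) (1≤k+ j)))
    (sepω-parse U (blocks₁ x) (λ j → g j ++ t-odd j ∷ vs (suc j)) layout₁ eq₁ refl (λ _ → refl) j)

  block₂ : ∀ j → B' x (2 * (k + j) + 1) ≡ us (suc j) ++ t-even j ∷ zs (suc j)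
  block₂ j = trans (sym (blocks₂-pos x (k + j) (1≤k+ j)))
    (sepω-parse V (blocks₂ x) (λ j → us (suc j) ++ t-even j ∷ zs (suc j)) layout₂ eq₂ refl (λ _ → refl) j)

  r : ℕ → ℕ
  r j = length (vs (suc j))

  |u|≡r : ∀ j → length (us (suc j)) ≡ r j
  |u|≡r j = sym (|v|≡|u| (suc j) (s≤s z≤n))

  zeros : ∀ j → DiagZero x (2 * (k + j)) (r j) × DiagZero x (2 * (k + j) + 1) (r j)
  zeros j =
    B-suffix-zero x _ (g j ++ [ t-odd j ]) (vs (suc j))
      (trans (block₁ j) (sym (++-assoc (g j) [ t-odd j ] (vs (suc j))))) (vs0 (suc j) (s≤s z≤n)) ,
    subst (DiagZero x _) (|u|≡r j)
      (B'-prefix-zero x _ (us (suc j)) _ (block₂ j) (us0 (suc j) (s≤s z≤n)))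

  length₁ : ∀ j → 2 * (k + j) ≡ length (g j) + suc (r j)
  length₁ j = trans (sym (length-B x _)) (trans (cong length (block₁ j)) (length-++ (g j)))

  length₂ : ∀ j → 2 * (k + j) + 1 ≡ r j + suc (length (zs (suc j)))
  length₂ j = trans (sym (length-B' x _))
    (trans (cong length (block₂ j)) (trans (length-++ (us (suc j))) (cong (_+ suc (length (zs (suc j)))) (|u|≡r j))))

  r-step : ∀ j → (length (gs (suc j)) ≡ suc (length (zs (suc j))) → r (suc j) ≡ r j)
               × (length (gs (suc j)) ≡ length (zs (suc j)) → r (suc j) ≡ suc (r j))
  r-step j = length-step _ _ _ _ (trans (sym (length₁ (suc j))) (trans (two-more k j) (cong suc (length₂ j))))
    where
    two-more : ∀ k j → 2 * (k + suc j) ≡ suc (2 * (k + j) + 1)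
    two-more = solve-∀

  -- Hence r never decreases, and increases infinitely often (the |g_i| = |z_i| case of R₁).
  r-mono : ∀ j → r j ≤ r (suc j)
  r-mono j with |g|~|z| (suc j) (s≤s z≤n)
  ... | inj₁ longer = ≤-reflexive (sym (proj₁ (r-step j) longer))
  ... | inj₂ equal = subst (r j ≤_) (sym (proj₂ (r-step j) equal)) (n≤1+n (r j))

  r-grows : ∀ N → ∃ λ j → N ≤ j × r j < r (suc j)
  r-grows N with inf (suc N)
  ... | suc j , s≤s N≤j , _ , equal = j , N≤j , ≤-reflexive (sym (proj₂ (r-step j) equal))

  rows-finite : P x
  rows-finite = P-from-diagonals x k r zeros (eventually-above r r-mono r-grows)

interleave : ∀ {L : Set} → (ℕ → L) → (ℕ → L) → ℕ → L
interleave f h zero = f 0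
interleave f h (suc i) = interleave h (f ∘ suc) i

double-suc : ∀ n → 2 * suc n ≡ suc (suc (2 * n))
double-suc = solve-∀

interleave-even : ∀ {L : Set} (f h : ℕ → L) n → interleave f h (2 * n) ≡ f n
interleave-even f h zero = refl
interleave-even f h (suc n) =
  trans (cong (interleave f h) (double-suc n)) (interleave-even (f ∘ suc) (h ∘ suc) n)

interleave-odd : ∀ {L : Set} (f h : ℕ → L) n → interleave f h (suc (2 * n)) ≡ h n
interleave-odd f h n = interleave-even h (f ∘ suc) n

-- Admitting rows one at a time against thresholds Th: at step j the next row r j is
-- admitted iff its threshold has been reached, Th (r j) ≤ j.
module Admission (Th : ℕ → ℕ) where

  admit : ℕ → ℕ → ℕ
  admit j a with Th a ≤? j
  ... | yes _ = suc a
  ... | no _ = a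

  r : ℕ → ℕ
  r zero = 0
  r (suc j) = admit j (r j)

  r-step : ∀ j → (Th (r j) ≤ j × r (suc j) ≡ suc (r j)) ⊎ (¬ Th (r j) ≤ j × r (suc j) ≡ r j)
  r-step j with Th (r j) ≤? j
  ... | yes reached = inj₁ (reached , refl)
  ... | no unreached = inj₂ (unreached , refl)

  r≤ : ∀ j → r j ≤ j
  r≤ zero = z≤n
  r≤ (suc j) with r-step j
  ... | inj₁ (_ , admitted) = subst (_≤ suc j) (sym admitted) (s≤s (r≤ j))
  ... | inj₂ (_ , stays) = subst (_≤ suc j) (sym stays) (m≤n⇒m≤1+n (r≤ j))

  admitted-rows : ∀ j i → i < r j → Th i ≤ j
  admitted-rows (suc j) i i<r with r-step j
  ... | inj₂ (_ , stays) = m≤n⇒m≤1+n (admitted-rows j i (subst (i <_) stays i<r))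
  ... | inj₁ (reached , admitted) with m<1+n⇒m<n∨m≡n (subst (i <_) admitted i<r)
  ...   | inj₁ i<rj = m≤n⇒m≤1+n (admitted-rows j i i<rj)
  ...   | inj₂ refl = m≤n⇒m≤1+n reached

  admitted-within : ∀ f j → Th (r j) ≤ f + j → ∃ λ j′ → j ≤ j′ × r (suc j′) ≡ suc (r j′)
  admitted-within f j Th≤ with r-step j
  ... | inj₁ (_ , admitted) = j , ≤-refl , admitted
  admitted-within zero j Th≤ | inj₂ (unreached , _) = ⊥-elim (unreached Th≤)
  admitted-within (suc f) j Th≤ | inj₂ (_ , stays)
    with admitted-within f (suc j) (subst (λ a → Th a ≤ f + suc j) (sym stays) (≤-trans Th≤ (≤-reflexive (sym (+-suc f j)))))
  ... | j′ , 1+j≤j′ , admitted = j′ , ≤-trans (n≤1+n j) 1+j≤j′ , admitted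

  r-grows : ∀ N → ∃ λ j → N ≤ j × r (suc j) ≡ suc (r j)
  r-grows N = admitted-within (Th (r N)) N (m≤m+n (Th (r N)) N)

not-b1 : ∀ {b} → ¬ b ≡ b1 → b ≡ b0
not-b1 {b0} _ = refl
not-b1 {b1} b≢b1 = ⊥-elim (b≢b1 refl)

-- P ⇒ R₁, with k = 1, U₁ = x(1,1) A and V₁ = A.
module ToR₁ (x : ℕ → ℕ → Bit) (px : P x) where

  -- Row i+1 vanishes from column N i on, hence on every antidiagonal p with Th i ≤ p.
  N Th : ℕ → ℕ
  N i = proj₁ (px (suc i) (s≤s z≤n))
  Th i = N i + i

  diag-beyond : ∀ p i → Th i ≤ p → diag x p i ≡ b0
  diag-beyond p i Th≤p = not-b1 (proj₂ (px (suc i) (s≤s z≤n)) (p ∸ i) (m+n≤o⇒m≤o∸n (N i) Th≤p))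

  open Admission Th

  p₁ p₂ : ℕ → ℕ
  p₁ j = 2 * suc j
  p₂ j = 2 * suc j + 1

  zeros : ∀ j → DiagZero x (p₁ j) (r j) × DiagZero x (p₂ j) (r j)
  zeros j = (λ i i<r → diag-beyond (p₁ j) i (≤-trans (admitted-rows j i i<r) j≤p₁))
          , (λ i i<r → diag-beyond (p₂ j) i (≤-trans (admitted-rows j i i<r) (≤-trans j≤p₁ (m≤m+n (p₁ j) 1))))
    where
    j≤p₁ : j ≤ p₁ j
    j≤p₁ = m≤n⇒m≤1+n (m≤m+n j _)

  -- a j = 2j + 1 - r j is the length of the part g_j of B_{p₁ j} before the cut.
  a : ℕ → ℕ
  a j = suc j + (j ∸ r j)

  -- The cut at row r j + 1 fits, since r j ≤ j.
  p₁≡ : ∀ j → p₁ j ≡ a j + suc (r j)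
  p₁≡ j = subst (λ J → 2 * suc J ≡ (suc J + (j ∸ r j)) + suc (r j)) (m+[n∸m]≡n (r≤ j)) (identity (r j) (j ∸ r j))
    where
    identity : ∀ r s → 2 * suc (r + s) ≡ (suc (r + s) + s) + suc r
    identity = solve-∀

  p₂≡ : ∀ j → p₂ j ≡ r j + suc (suc (a j))
  p₂≡ j = subst (λ J → 2 * suc J + 1 ≡ r j + suc (suc (suc J + (j ∸ r j)))) (m+[n∸m]≡n (r≤ j)) (identity (r j) (j ∸ r j))
    where
    identity : ∀ r s → 2 * suc (r + s) + 1 ≡ r + suc (suc (suc (r + s) + s))
    identity = solve-∀

  g v u z : ℕ → List Bit
  g j = applyDownFrom (λ i → diag x (p₁ j) (i + suc (r j))) (a j)
  v j = applyDownFrom (diag x (p₁ j)) (r j)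
  u j = applyUpTo (diag x (p₂ j)) (r j)
  z j = applyUpTo (λ i → diag x (p₂ j) (r j + suc i)) (suc (a j))

  t-odd t-even t : ℕ → Bit
  t-odd j = diag x (p₁ j) (r j)
  t-even j = diag x (p₂ j) (r j)
  t zero = b0
  t (suc i) = interleave t-odd t-even i

  t-odd-at : ∀ j → t (2 * j + 1) ≡ t-odd j
  t-odd-at j = trans (cong t (+-comm (2 * j) 1)) (interleave-even t-odd t-even j)

  t-even-at : ∀ j → t (2 * suc j) ≡ t-even j
  t-even-at j = trans (cong t (double-suc j)) (interleave-odd t-odd t-even j)

  cut₁ : ∀ j → B x (p₁ j) ≡ g j ++ t-odd j ∷ v j
  cut₁ j = B-split x (p₁ j) (a j) (r j) (p₁≡ j)

  cut₂ : ∀ j → B' x (p₂ j) ≡ u j ++ t-even j ∷ z j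
  cut₂ j = B'-split x (p₂ j) (r j) (suc (a j)) (p₂≡ j)

  g-vs-z : ∀ j → (r (suc j) ≡ suc (r j) → length (g (suc j)) ≡ length (z j))
               × (r (suc j) ≡ r j → length (g (suc j)) ≡ suc (length (z j)))
  g-vs-z j = admitted , stays
    where
    |g| : length (g (suc j)) ≡ a (suc j)
    |g| = length-applyDownFrom (λ i → diag x (p₁ (suc j)) (i + suc (r (suc j)))) (a (suc j))
    |z| : length (z j) ≡ suc (a j)
    |z| = length-applyUpTo (λ i → diag x (p₂ j) (r j + suc i)) (suc (a j))
    admitted : r (suc j) ≡ suc (r j) → length (g (suc j)) ≡ length (z j)
    admitted e = trans |g| (trans (cong (λ ρ → suc (suc j) + (suc j ∸ ρ)) e) (sym |z|))
    stays : r (suc j) ≡ r j → length (g (suc j)) ≡ suc (length (z j))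
    stays e = trans |g| (trans (cong (λ ρ → suc (suc j) + (suc j ∸ ρ)) e)
      (trans (cong (suc (suc j) +_) (+-∸-assoc 1 (r≤ j)))
      (trans (cong suc (+-suc (suc j) (j ∸ r j))) (cong suc (sym |z|)))))

  layout₁ layout₂ : ℕ → List Letter
  layout₁ zero = flat ((x 1 1 ∷ []) ∷ []) ++ ⌜ g 0 ++ t 1 ∷ v 0 ⌝
  layout₁ (suc n) = ⌜ g (suc n) ++ t (2 * suc n + 1) ∷ v (suc n) ⌝
  layout₂ zero = flat ([] ∷ []) ++ ⌜ u 0 ++ t 2 ∷ z 0 ⌝
  layout₂ (suc n) = ⌜ u (suc n) ++ t (2 * suc (suc n)) ∷ z (suc n) ⌝

  σ₁-layout : σ₁ x ≈ω sepω layout₁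
  σ₁-layout = sepω-merge (λ j → ⌜ blocks₁ x j ⌝) layout₁
    (cong (λ w → bit (x 1 1) ∷ A ∷ ⌜ w ⌝) (sym (cut₁ 0)))
    (λ n → cong ⌜_⌝ (trans (cong (λ b → g (suc n) ++ b ∷ v (suc n)) (t-odd-at (suc n))) (sym (cut₁ (suc n)))))

  σ₂-layout : σ₂ x ≈ω sepω layout₂
  σ₂-layout = sepω-merge (λ j → ⌜ blocks₂ x j ⌝) layout₂
    (cong (λ w → A ∷ ⌜ w ⌝) (sym (cut₂ 0)))
    (λ n → cong ⌜_⌝ (trans (cong (λ b → u (suc n) ++ b ∷ z (suc n)) (t-even-at (suc n))) (sym (cut₂ (suc n)))))

  -- Sequences indexed from 1: shifted j ↦ w (j - 1).
  shifted : (ℕ → List Bit) → ℕ → List Bit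
  shifted w zero = []
  shifted w (suc j) = w j

  u-zeros : ∀ i → 1 ≤ i → Zeros (shifted u i)
  u-zeros (suc j) _ = applyUpTo⁺₁ (diag x (p₂ j)) (r j) (λ {i} → proj₂ (zeros j) i)

  v-zeros : ∀ i → 1 ≤ i → Zeros (shifted v i)
  v-zeros (suc j) _ = applyDownFrom⁺₁ (diag x (p₁ j)) (r j) (λ {i} → proj₁ (zeros j) i)

  |v|≡|u| : ∀ i → 1 ≤ i → length (shifted v i) ≡ length (shifted u i)
  |v|≡|u| (suc j) _ = trans (length-applyDownFrom _ (r j)) (sym (length-applyUpTo _ (r j)))

  |g|~|z| : ∀ i → 1 ≤ i → length (g i) ≡ suc (length (shifted z i)) ⊎ length (g i) ≡ length (shifted z i)
  |g|~|z| (suc j) _ with r-step j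
  ... | inj₁ (_ , admitted) = inj₂ (proj₁ (g-vs-z j) admitted)
  ... | inj₂ (_ , stays) = inj₁ (proj₂ (g-vs-z j) stays)

  |g|≡|z|-often : ∀ M → ∃ λ i → M ≤ i × 1 ≤ i × length (g i) ≡ length (shifted z i)
  |g|≡|z|-often M with r-grows M
  ... | j , M≤j , admitted = suc j , m≤n⇒m≤1+n M≤j , s≤s z≤n , proj₁ (g-vs-z j) admitted

  witness : R₁ (σ₁ x) (σ₂ x)
  witness = record
    { k = 1 ; 1≤k = s≤s z≤n ; U = (x 1 1 ∷ []) ∷ [] ; V = [] ∷ []
    ; u = g 0 ; t = t ; us = shifted u ; vs = shifted v ; gs = g ; zs = shifted z
    ; us0 = u-zeros ; vs0 = v-zeros ; |v|≡|u| = |v|≡|u| ; |g|~|z| = |g|~|z| ; inf = |g|≡|z|-often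
    ; eq₁ = σ₁-layout ; eq₂ = σ₂-layout }

lemma11 : (x : ℕ → ℕ → Bit) → (R₁ (σ₁ x) (σ₂ x) → P x) × (P x → R₁ (σ₁ x) (σ₂ x))
lemma11 x = FromR₁.rows-finite x , ToR₁.witness x
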